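{- For $n \geq 3$ and $k \geq 0$: $\mathscr{I}(C_n) \cong K_3$ if $n = 3$; $\mathscr{I}(C_n) \cong 3K_1$ if $n = 3k \geq 6$; and $\mathscr{I}(C_n) \cong C_n$ if $n \equiv 2 \pmod 3$.
   Context: For a graph $G$, an $i$-set is an independent dominating set of minimum size. The $i$-graph $\mathscr{I}(G)$ has the $i$-sets of $G$ as vertices, with $X,Y$ adjacent if and only if there is an edge $xy\in E(G)$ with $x\in X$, $y \notin X$ and $Y=(X\setminus\{x\})\cup\{y\}$. $C_n$ is the cycle on $n$ vertices and $3K_1$ is the edgeless graph on three vertices. -}

module Defs where

open import Data.Nat using (ℕ; zero; suc; _≤_)
open import Data.Fin using (Fin; toℕ)
open import Data.Fin.Subset using (Subset; _∈_; _∉_; ∣_∣; inside; outside)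
open import Data.Vec using (_[_]≔_)
open import Data.Product using (Σ; ∃; ∃-syntax; _×_)
open import Data.Sum using (_⊎_)
open import Data.Empty using (⊥)
open import Relation.Nullary using (¬_)
open import Relation.Binary.PropositionalEquality using (_≡_; _≢_)
open import Function.Bundles using (_⇔_)
open import Function.Definitions using (Injective)

Graph : ℕ → Set₁
Graph n = Fin n → Fin n → Set

Cycle : (n : ℕ) → Graph n
Cycle n i j =
  (suc (toℕ i) ≡ toℕ j) ⊎ (suc (toℕ j) ≡ toℕ i)
  ⊎ (toℕ i ≡ 0 × suc (toℕ j) ≡ n) ⊎ (toℕ j ≡ 0 × suc (toℕ i) ≡ n)

Complete : (m : ℕ) → Graph m
Complete m i j = i ≢ j

Edgeless : (m : ℕ) → Graph m
Edgeless m i j = ⊥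

module _ {n : ℕ} (G : Graph n) where

  Independent : Subset n → Set
  Independent S = ∀ x y → x ∈ S → y ∈ S → ¬ G x y

  Dominating : Subset n → Set
  Dominating S = ∀ v → v ∈ S ⊎ (∃[ u ] (u ∈ S × G u v))

  IndepDominating : Subset n → Set
  IndepDominating S = Independent S × Dominating S

  IsISet : Subset n → Set
  IsISet S = IndepDominating S × (∀ T → IndepDominating T → ∣ S ∣ ≤ ∣ T ∣)

  IAdj : Subset n → Subset n → Set
  IAdj X Y = ∃[ x ] ∃[ y ] (G x y × x ∈ X × y ∉ X × Y ≡ ((X [ x ]≔ outside) [ y ]≔ inside))

  -- 𝓘(G) ≅ H : a bijection φ from the vertices of H onto the i-sets of G
  -- such that i ~_H j iff φ i ~ φ j in the i-graph.
  IGraphIso : {m : ℕ} → Graph m → Set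
  IGraphIso {m} H =
    Σ (Fin m → Subset n) λ φ →
      (∀ i → IsISet (φ i))
      × Injective _≡_ _≡_ φ
      × (∀ S → IsISet S → ∃[ i ] (φ i ≡ S))
      × (∀ i j → H i j ⇔ IAdj (φ i) (φ j))

-- Encode a vertex set S of C_n by its n-periodic indicator sequence χ S on ℕ and look at
-- windows, the triples m, m + 1, m + 2.  S dominates iff no window misses S, and every vertex
-- lies in three windows per period, so summing windows gives n ≤ 3 ∣ S ∣; for an independent
-- S a window meeting S twice reads 1, 0, 1.
--
-- If 3 divides n, an i-set has one member in every window, so it is a residue class modulo 3.
-- Replacing x ∈ X by a neighbour y preserves domination only if X contains a vertex at distance
-- two from x, which a residue class does not when n ≥ 6; for n = 3 the i-sets are the three
-- singletons, pairwise adjacent.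
--
-- If n = 3k + 2, the windows of an i-set sum to n + 1, so exactly one window meets it twice, and
-- that window determines the set as a rotation of {0, 2, 5, …, n − 3}.  Rotating by 3 is a single
-- move, every move between such sets is a rotation by ±3, and 3 is invertible modulo n; hence
-- i ↦ (rotation by 3 i) is an isomorphism from C_n onto its i-graph.

module Submission where

open import Defs
open import Data.Nat using (ℕ; zero; suc; _+_; _*_; _∸_; _≤_; _<_; _≤?_; z≤n; s≤s; z<s; s<s; s≤s⁻¹; _≟_; pred; NonZero; >-nonZero⁻¹)
open import Data.Nat.Properties
open import Data.Nat.DivMod using (_%_; _/_; _mod_; m≡m%n+[m/n]*n; %-distribˡ-+; %-distribˡ-*; m%n%n≡m%n; [m+n]%n≡m%n; n%n≡0; m<n⇒m%n≡m; m%n<n; m*n%n≡0; [m+kn]%n≡m%n)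
open import Data.Bool using (Bool; true; false)
open import Data.Fin using (Fin; toℕ; zero; suc)
import Data.Fin.Properties as Finₚ
open import Data.Fin.Subset using (Subset; _∈_; _∉_; ∣_∣; inside; outside)
open import Data.Vec using ([]; _∷_; lookup; tabulate; _[_]≔_)
open import Data.Vec.Properties using ([]=⇒lookup; lookup⇒[]=; lookup∘tabulate; tabulate∘lookup; tabulate-cong; lookup∘update; lookup∘update′; []≔-idempotent; []≔-commutes; []≔-lookup)
open import Data.Product using (_×_; _,_; proj₁; proj₂; ∃-syntax)
open import Data.Sum using (_⊎_; inj₁; inj₂)
open import Data.Empty using (⊥; ⊥-elim)
open import Relation.Nullary using (¬_; Dec; yes; no)
open import Relation.Binary.PropositionalEquality
open import Function using (_∘_)
open import Function.Bundles using (_⇔_; mk⇔)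
open import Algebra.Properties.CommutativeSemigroup +-commutativeSemigroup using (interchange; x∙yz≈y∙xz)

-- Finite sums

sum< : (ℕ → ℕ) → ℕ → ℕ
sum< f zero = 0
sum< f (suc L) = f 0 + sum< (f ∘ suc) L

sum<-cong : ∀ {f g : ℕ → ℕ} L → (∀ m → m < L → f m ≡ g m) → sum< f L ≡ sum< g L
sum<-cong zero eq = refl
sum<-cong (suc L) eq = cong₂ _+_ (eq 0 z<s) (sum<-cong L (λ m m<L → eq (suc m) (s<s m<L)))

sum<-+ : ∀ (f g : ℕ → ℕ) L → sum< (λ m → f m + g m) L ≡ sum< f L + sum< g L
sum<-+ f g zero = refl
sum<-+ f g (suc L) = begin
    f 0 + g 0 + sum< (λ m → f (suc m) + g (suc m)) L
      ≡⟨ cong (f 0 + g 0 +_) (sum<-+ (f ∘ suc) (g ∘ suc) L) ⟩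
    f 0 + g 0 + (sum< (f ∘ suc) L + sum< (g ∘ suc) L)
      ≡⟨ interchange (f 0) (g 0) _ _ ⟩
    f 0 + sum< (f ∘ suc) L + (g 0 + sum< (g ∘ suc) L) ∎
  where open ≡-Reasoning

sum<-suc : ∀ (f : ℕ → ℕ) L → sum< f (suc L) ≡ sum< f L + f L
sum<-suc f zero = +-comm (f 0) 0
sum<-suc f (suc L) = trans (cong (f 0 +_) (sum<-suc (f ∘ suc) L)) (sym (+-assoc (f 0) _ _))

Periodic : ℕ → (ℕ → ℕ) → Set
Periodic n f = ∀ m → f (m + n) ≡ f m

sum<-rotate : ∀ n (f : ℕ → ℕ) → Periodic n f → ∀ c → sum< (λ m → f (c + m)) n ≡ sum< f n
sum<-rotate n f per zero = refl
sum<-rotate n f per (suc c) =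
  trans (sum<-rotate n (f ∘ suc) (per ∘ suc) c) (+-cancelˡ-≡ (f 0) _ _ (begin
    f 0 + sum< (f ∘ suc) n ≡⟨ sum<-suc f n ⟩
    sum< f n + f n         ≡⟨ cong (sum< f n +_) (per 0) ⟩
    sum< f n + f 0         ≡⟨ +-comm (sum< f n) (f 0) ⟩
    f 0 + sum< f n         ∎))
  where open ≡-Reasoning

sum<-ones : ∀ (f : ℕ → ℕ) L → (∀ m → m < L → f m ≡ 1) → sum< f L ≡ L
sum<-ones f zero _ = refl
sum<-ones f (suc L) ones = cong₂ _+_ (ones 0 z<s) (sum<-ones (f ∘ suc) L (λ m m<L → ones (suc m) (s<s m<L)))

sum<-positive : ∀ (f : ℕ → ℕ) L → (∀ m → m < L → 1 ≤ f m) → L ≤ sum< f L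
sum<-positive f zero _ = z≤n
sum<-positive f (suc L) pos = +-mono-≤ (pos 0 z<s) (sum<-positive (f ∘ suc) L (λ m m<L → pos (suc m) (s<s m<L)))

sum<-positive-tight : ∀ (f : ℕ → ℕ) L → (∀ m → m < L → 1 ≤ f m) → sum< f L ≤ L →
                      ∀ m → m < L → f m ≡ 1
sum<-positive-tight f (suc L) pos sum≤ zero _ =
  ≤-antisym (+-cancelʳ-≤ L (f 0) 1 (≤-trans (+-monoʳ-≤ (f 0) (sum<-positive (f ∘ suc) L pos′)) sum≤))
            (pos 0 z<s)
  where pos′ = λ m m<L → pos (suc m) (s<s m<L)
sum<-positive-tight f (suc L) pos sum≤ (suc m) (s≤s m<L) =
  sum<-positive-tight (f ∘ suc) L pos′ (+-cancelˡ-≤ 1 _ L (≤-trans (+-monoˡ-≤ _ (pos 0 z<s)) sum≤)) m m<L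
  where pos′ = λ m m<L → pos (suc m) (s<s m<L)

sum<-large : ∀ (f : ℕ → ℕ) L → L < sum< f L → ∃[ m ] (m < L × 2 ≤ f m)
sum<-large f (suc L) L<sum with 2 ≤? f 0
... | yes 2≤f0 = 0 , z<s , 2≤f0
... | no 2≰f0
  with sum<-large (f ∘ suc) L (+-cancelˡ-< 1 _ _ (≤-trans L<sum (+-monoˡ-≤ _ (s≤s⁻¹ (≰⇒> 2≰f0)))))
...   | m , m<L , 2≤fm = suc m , s<s m<L , 2≤fm

sum<-excess-at-0 : ∀ (f : ℕ → ℕ) L → (∀ m → m < suc L → 1 ≤ f m) → sum< f (suc L) ≤ 2 + L →
                   2 ≤ f 0 → ∀ m → 0 < m → m < suc L → f m ≡ 1
sum<-excess-at-0 f L pos sum≤ 2≤f0 (suc m) _ (s≤s m<L) =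
  sum<-positive-tight (f ∘ suc) L (λ m m<L → pos (suc m) (s<s m<L))
    (+-cancelˡ-≤ 2 _ L (≤-trans (+-monoˡ-≤ _ 2≤f0) sum≤)) m m<L

-- Windows of Boolean sequences

bit : Bool → ℕ
bit true = 1
bit false = 0

window : (ℕ → Bool) → ℕ → ℕ
window f m = bit (f m) + bit (f (suc m)) + bit (f (suc (suc m)))

window-from : ∀ f a {u v w} → f a ≡ u → f (suc a) ≡ v → f (2 + a) ≡ w → window f a ≡ bit u + bit v + bit w
window-from f a e₀ e₁ e₂ = cong₂ _+_ (cong₂ _+_ (cong bit e₀) (cong bit e₁)) (cong bit e₂)

Hit : (ℕ → Bool) → ℕ → Set
Hit f m = f m ≡ true ⊎ f (suc m) ≡ true ⊎ f (suc (suc m)) ≡ true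

hit⇒window≥1 : ∀ f m → Hit f m → 1 ≤ window f m
hit⇒window≥1 f m hit with f m | f (suc m) | f (suc (suc m)) | hit
... | true  | _     | _     | _ = s≤s z≤n
... | false | true  | _     | _ = s≤s z≤n
... | false | false | true  | _ = s≤s z≤n
... | false | false | false | inj₁ ()
... | false | false | false | inj₂ (inj₁ ())
... | false | false | false | inj₂ (inj₂ ())

window≥1⇒hit : ∀ f m → 1 ≤ window f m → Hit f m
window≥1⇒hit f m w≥1 with f m | f (suc m) | f (suc (suc m))
... | true  | _     | _     = inj₁ refl
... | false | true  | _     = inj₂ (inj₁ refl)
... | false | false | true  = inj₂ (inj₂ refl)
... | false | false | false with () ← w≥1

IndependentSeq : (ℕ → Bool) → Set
IndependentSeq f = ∀ m → f m ≡ true → f (suc m) ≡ true → ⊥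

DominatingSeq : (ℕ → Bool) → Set
DominatingSeq f = ∀ m → 1 ≤ window f m

window≥2⇒101 : ∀ f → IndependentSeq f → ∀ m → 2 ≤ window f m →
               f m ≡ true × f (suc m) ≡ false × f (suc (suc m)) ≡ true
window≥2⇒101 f ind m w≥2 with f m in e₀ | f (suc m) in e₁ | f (suc (suc m)) in e₂
... | true  | false | true  = refl , refl , refl
... | true  | true  | _     = ⊥-elim (ind m e₀ e₁)
... | false | true  | true  = ⊥-elim (ind (suc m) e₁ e₂)
... | true  | false | false with s≤s () ← w≥2
... | false | true  | false with s≤s () ← w≥2
... | false | false | true  with s≤s () ← w≥2
... | false | false | false with () ← w≥2

101⇒window≥2 : ∀ f m → f m ≡ true → f (suc (suc m)) ≡ true → 2 ≤ window f m
101⇒window≥2 f m e₀ e₂ rewrite e₀ | e₂ with f (suc m)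
... | true  = s≤s (s≤s z≤n)
... | false = s≤s (s≤s z≤n)

11⇒window≥2 : ∀ f m → f m ≡ true → f (suc m) ≡ true → 2 ≤ window f m
11⇒window≥2 f m e₀ e₁ rewrite e₀ | e₁ with f (suc (suc m))
... | true  = s≤s (s≤s z≤n)
... | false = s≤s (s≤s z≤n)

window≤1⇒independent : ∀ f → (∀ m → window f m ≤ 1) → IndependentSeq f
window≤1⇒independent f w≤1 m e₀ e₁ with s≤s () ← ≤-trans (11⇒window≥2 f m e₀ e₁) (w≤1 m)

bit-injective : ∀ {a b} → bit a ≡ bit b → a ≡ b
bit-injective {true}  {true}  _ = refl
bit-injective {false} {false} _ = refl

window-next : ∀ (f g : ℕ → Bool) m → window f m ≡ window g m → f m ≡ g m → f (suc m) ≡ g (suc m) →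
              f (2 + m) ≡ g (2 + m)
window-next f g m w-eq e₀ e₁ = bit-injective (+-cancelˡ-≡ (bit (f m) + bit (f (suc m))) _ _ (begin
    bit (f m) + bit (f (suc m)) + bit (f (2 + m))  ≡⟨ w-eq ⟩
    bit (g m) + bit (g (suc m)) + bit (g (2 + m))  ≡⟨ cong₂ (λ u v → bit u + bit v + bit (g (2 + m))) e₀ e₁ ⟨
    bit (f m) + bit (f (suc m)) + bit (g (2 + m))  ∎))
  where open ≡-Reasoning

windows-agree : ∀ (f g : ℕ → Bool) → (∀ m → window f m ≡ window g m) →
                f 0 ≡ g 0 → f 1 ≡ g 1 → f 2 ≡ g 2 → ∀ m → f m ≡ g m
windows-agree f g w e₀ e₁ e₂ 0 = e₀
windows-agree f g w e₀ e₁ e₂ 1 = e₁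
windows-agree f g w e₀ e₁ e₂ 2 = e₂
windows-agree f g w e₀ e₁ e₂ (suc (suc (suc m))) =
  window-next f g (suc m) (w (suc m))
    (windows-agree f g w e₀ e₁ e₂ (suc m)) (windows-agree f g w e₀ e₁ e₂ (suc (suc m)))

sum<-window : ∀ n (f : ℕ → Bool) → Periodic n (bit ∘ f) → sum< (window f) n ≡ 3 * sum< (bit ∘ f) n
sum<-window n f per = begin
    sum< (window f) n
      ≡⟨ sum<-+ (λ m → bit (f m) + bit (f (suc m))) (λ m → bit (f (2 + m))) n ⟩
    sum< (λ m → bit (f m) + bit (f (suc m))) n + sum< (λ m → bit (f (2 + m))) n
      ≡⟨ cong₂ _+_ (sum<-+ (bit ∘ f) (λ m → bit (f (suc m))) n) (sum<-rotate n (bit ∘ f) per 2) ⟩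
    s + sum< (λ m → bit (f (1 + m))) n + s
      ≡⟨ cong (λ t → s + t + s) (sum<-rotate n (bit ∘ f) per 1) ⟩
    s + s + s
      ≡⟨ +-assoc s s s ⟩
    s + (s + s)
      ≡⟨ cong (λ t → s + (s + t)) (sym (+-identityʳ s)) ⟩
    3 * s ∎
  where
  open ≡-Reasoning
  s = sum< (bit ∘ f) n

-- Subsets of Fin n

∣∣≡sum< : ∀ {L} (S : Subset L) (g : ℕ → Bool) → (∀ i → g (toℕ i) ≡ lookup S i) →
          ∣ S ∣ ≡ sum< (bit ∘ g) L
∣∣≡sum< [] g _ = refl
∣∣≡sum< (b ∷ S) g agree with g 0 | agree zero
... | true  | refl = cong suc (∣∣≡sum< S (g ∘ suc) (agree ∘ suc))
... | false | refl = ∣∣≡sum< S (g ∘ suc) (agree ∘ suc)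

swap : ∀ {n} → Subset n → Fin n → Fin n → Subset n
swap X x y = (X [ x ]≔ outside) [ y ]≔ inside

∉⇒lookup≡outside : ∀ {n} {X : Subset n} {y} → y ∉ X → lookup X y ≡ outside
∉⇒lookup≡outside {X = X} {y} y∉X with lookup X y in eq
... | true  = ⊥-elim (y∉X (lookup⇒[]= y X eq))
... | false = refl

∈∧∉⇒≢ : ∀ {n} {X : Subset n} {x y} → x ∈ X → y ∉ X → x ≢ y
∈∧∉⇒≢ x∈X y∉X refl = y∉X x∈X

swap-swap : ∀ {n} (X : Subset n) {x y} → x ∈ X → y ∉ X → swap (swap X x y) y x ≡ X
swap-swap X {x} {y} x∈X y∉X = begin
    ((((X [ x ]≔ outside) [ y ]≔ inside) [ y ]≔ outside) [ x ]≔ inside)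
      ≡⟨ cong (_[ x ]≔ inside) ([]≔-idempotent (X [ x ]≔ outside) y) ⟩
    (((X [ x ]≔ outside) [ y ]≔ outside) [ x ]≔ inside)
      ≡⟨ cong (_[ x ]≔ inside) ([]≔-commutes X x y x≢y) ⟩
    (((X [ y ]≔ outside) [ x ]≔ outside) [ x ]≔ inside)
      ≡⟨ []≔-idempotent (X [ y ]≔ outside) x ⟩
    ((X [ y ]≔ outside) [ x ]≔ inside)
      ≡⟨ cong₂ (λ a b → (X [ y ]≔ a) [ x ]≔ b) (∉⇒lookup≡outside y∉X) ([]=⇒lookup x∈X) ⟨
    ((X [ y ]≔ lookup X y) [ x ]≔ lookup X x)
      ≡⟨ cong (λ Z → Z [ x ]≔ lookup X x) ([]≔-lookup X y) ⟩
    (X [ x ]≔ lookup X x)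
      ≡⟨ []≔-lookup X x ⟩
    X ∎
  where
  open ≡-Reasoning
  x≢y = ∈∧∉⇒≢ x∈X y∉X

swap-IAdj : ∀ {n} (G : Graph n) {X x y} → G x y → x ∈ X → y ∉ X → IAdj G X (swap X x y)
swap-IAdj G {x = x} {y} xy x∈X y∉X = x , y , xy , x∈X , y∉X , refl

swap-IAdj⁻ : ∀ {n} (G : Graph n) {X x y} → G y x → x ∈ X → y ∉ X → IAdj G (swap X x y) X
swap-IAdj⁻ G {X} {x} {y} yx x∈X y∉X =
  y , x , yx , y∈swap , x∉swap , sym (swap-swap X x∈X y∉X)
  where
  y∈swap : y ∈ swap X x y
  y∈swap = lookup⇒[]= y _ (lookup∘update y (X [ x ]≔ outside) inside)
  x∉swap : x ∉ swap X x y
  x∉swap x∈swap with () ← trans (sym ([]=⇒lookup x∈swap))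
    (trans (lookup∘update′ (∈∧∉⇒≢ x∈X y∉X) (X [ x ]≔ outside) inside) (lookup∘update x X outside))

IAdj-irreflexive : ∀ {n} (G : Graph n) {X} → ¬ IAdj G X X
IAdj-irreflexive G {X} (x , y , _ , _ , y∉X , X≡swap) =
  y∉X (lookup⇒[]= y X (trans (cong (λ Z → lookup Z y) X≡swap) (lookup∘update y (X [ x ]≔ outside) inside)))

module Modulo (n : ℕ) .{{_ : NonZero n}} where

  infix 4 _≈_
  _≈_ : ℕ → ℕ → Set
  a ≈ b = a % n ≡ b % n

  _≈?_ : ∀ a b → Dec (a ≈ b)
  a ≈? b = a % n ≟ b % n

  %-≈ : ∀ a → a % n ≈ a
  %-≈ a = m%n%n≡m%n a n

  +-≈ : ∀ {a b c d} → a ≈ b → c ≈ d → a + c ≈ b + d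
  +-≈ {a} {b} {c} {d} a≈b c≈d = begin
      (a + c) % n           ≡⟨ %-distribˡ-+ a c n ⟩
      (a % n + c % n) % n   ≡⟨ cong₂ (λ x y → (x + y) % n) a≈b c≈d ⟩
      (b % n + d % n) % n   ≡⟨ %-distribˡ-+ b d n ⟨
      (b + d) % n           ∎
    where open ≡-Reasoning

  +-≈ˡ : ∀ a {c d} → c ≈ d → a + c ≈ a + d
  +-≈ˡ a = +-≈ {a} {a} refl

  +-≈ʳ : ∀ {a b} → a ≈ b → ∀ c → a + c ≈ b + c
  +-≈ʳ a≈b c = +-≈ {c = c} {c} a≈b refl

  *-≈ : ∀ {a b c d} → a ≈ b → c ≈ d → a * c ≈ b * d
  *-≈ {a} {b} {c} {d} a≈b c≈d = begin
      (a * c) % n             ≡⟨ %-distribˡ-* a c n ⟩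
      (a % n * (c % n)) % n   ≡⟨ cong₂ (λ x y → (x * y) % n) a≈b c≈d ⟩
      (b % n * (d % n)) % n   ≡⟨ %-distribˡ-* b d n ⟨
      (b * d) % n             ∎
    where open ≡-Reasoning

  n≈0 : n ≈ 0
  n≈0 = trans (n%n≡0 n) (sym (m<n⇒m%n≡m (>-nonZero⁻¹ n)))

  +n≈ : ∀ a → a + n ≈ a
  +n≈ a = [m+n]%n≡m%n a n

  ≈⇒≡ : ∀ {a b} → a < n → b < n → a ≈ b → a ≡ b
  ≈⇒≡ a<n b<n a≈b = trans (sym (m<n⇒m%n≡m a<n)) (trans a≈b (m<n⇒m%n≡m b<n))

  negate : ℕ → ℕ
  negate a = n ∸ a % n

  +-negate : ∀ a → a + negate a ≈ 0
  +-negate a = trans (+-≈ (sym (%-≈ a)) refl)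
                     (trans (cong (_% n) (m+[n∸m]≡n (<⇒≤ (m%n<n a n)))) n≈0)

  negate-+ : ∀ a → negate a + a ≈ 0
  negate-+ a = trans (cong (_% n) (+-comm (negate a) a)) (+-negate a)

  +-cancelˡ-≈ : ∀ a {b c} → a + b ≈ a + c → b ≈ c
  +-cancelˡ-≈ a {b} {c} a+b≈a+c = begin
      b % n                    ≡⟨ +-≈ (sym (negate-+ a)) refl ⟩
      (negate a + a + b) % n   ≡⟨ cong (_% n) (+-assoc (negate a) a b) ⟩
      (negate a + (a + b)) % n ≡⟨ +-≈ˡ (negate a) a+b≈a+c ⟩
      (negate a + (a + c)) % n ≡⟨ cong (_% n) (+-assoc (negate a) a c) ⟨
      (negate a + a + c) % n   ≡⟨ +-≈ (negate-+ a) refl ⟩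
      c % n                    ∎
    where open ≡-Reasoning

  +-cancelʳ-≈ : ∀ c {a b} → a + c ≈ b + c → a ≈ b
  +-cancelʳ-≈ c {a} {b} a+c≈b+c =
    +-cancelˡ-≈ c (trans (cong (_% n) (+-comm c a)) (trans a+c≈b+c (cong (_% n) (+-comm b c))))

  %-negate-offset : ∀ p m → (m + negate p) % n + p ≈ m
  %-negate-offset p m = begin
      ((m + negate p) % n + p) % n  ≡⟨ +-≈ʳ {(m + negate p) % n} {m + negate p} (%-≈ (m + negate p)) p ⟩
      (m + negate p + p) % n        ≡⟨ cong (_% n) (+-assoc m (negate p) p) ⟩
      (m + (negate p + p)) % n      ≡⟨ +-≈ˡ m {negate p + p} {0} (negate-+ p) ⟩
      (m + 0) % n                   ≡⟨ cong (_% n) (+-identityʳ m) ⟩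
      m % n                         ∎
    where open ≡-Reasoning

  +∸-≈ : ∀ a {k} → k ≤ n → k + (a + (n ∸ k)) ≈ a
  +∸-≈ a {k} k≤n = begin
      (k + (a + (n ∸ k))) % n  ≡⟨ cong (_% n) (x∙yz≈y∙xz k a (n ∸ k)) ⟩
      (a + (k + (n ∸ k))) % n  ≡⟨ cong (λ t → (a + t) % n) (m+[n∸m]≡n k≤n) ⟩
      (a + n) % n              ≡⟨ +n≈ a ⟩
      a % n                    ∎
    where open ≡-Reasoning

  +-≉ : ∀ k a → .{{NonZero k}} → k < n → ¬ k + a ≈ a
  +-≉ k a k<n k+a≈a = <⇒≢ (>-nonZero⁻¹ k) (sym (≈⇒≡ k<n (>-nonZero⁻¹ n) (+-cancelˡ-≈ a a+k≈a+0)))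
    where
    a+k≈a+0 : a + k ≈ a + 0
    a+k≈a+0 = trans (cong (_% n) (+-comm a k)) (trans k+a≈a (cong (_% n) (sym (+-identityʳ a))))

module CycleSets (n : ℕ) .{{_ : NonZero n}} where

  open Modulo n public

  χ : Subset n → ℕ → Bool
  χ S m = lookup S (m mod n)

  toℕ-mod : ∀ m → toℕ (m mod n) ≡ m % n
  toℕ-mod m = Finₚ.toℕ-fromℕ< (m%n<n m n)

  toℕ-mod-≈ : ∀ m → toℕ (m mod n) ≈ m
  toℕ-mod-≈ m = trans (cong (_% n) (toℕ-mod m)) (%-≈ m)

  ≈⇒mod≡ : ∀ {m} {x : Fin n} → m ≈ toℕ x → m mod n ≡ x
  ≈⇒mod≡ {m} {x} m≈x = Finₚ.toℕ-injective (begin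
      toℕ (m mod n)  ≡⟨ toℕ-mod m ⟩
      m % n          ≡⟨ m≈x ⟩
      toℕ x % n      ≡⟨ m<n⇒m%n≡m (Finₚ.toℕ<n x) ⟩
      toℕ x          ∎)
    where open ≡-Reasoning

  mod≡⇒≈ : ∀ {m} {x : Fin n} → m mod n ≡ x → m ≈ toℕ x
  mod≡⇒≈ {m} refl = sym (toℕ-mod-≈ m)

  χ-cong : ∀ S {a b} → a ≈ b → χ S a ≡ χ S b
  χ-cong S {a} {b} a≈b = cong (lookup S) (≈⇒mod≡ (trans a≈b (sym (toℕ-mod-≈ b))))

  χ-toℕ : ∀ S (i : Fin n) → χ S (toℕ i) ≡ lookup S i
  χ-toℕ S i = cong (lookup S) (≈⇒mod≡ refl)

  ∈⇒χ : ∀ {S} {x : Fin n} → x ∈ S → χ S (toℕ x) ≡ true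
  ∈⇒χ {S} {x} x∈S = trans (χ-toℕ S x) ([]=⇒lookup x∈S)

  χ⇒∈ : ∀ {S} {x : Fin n} → χ S (toℕ x) ≡ true → x ∈ S
  χ⇒∈ {S} {x} χx = lookup⇒[]= x S (trans (sym (χ-toℕ S x)) χx)

  χ⇒mod∈ : ∀ {S} m → χ S m ≡ true → m mod n ∈ S
  χ⇒mod∈ {S} m χm = lookup⇒[]= (m mod n) S χm

  Respects≈ : (ℕ → Bool) → Set
  Respects≈ g = ∀ a b → a ≈ b → g a ≡ g b

  window-≈ : ∀ g → Respects≈ g → ∀ {a b} → a ≈ b → window g a ≡ window g b
  window-≈ g resp {a} {b} a≈b =
    cong₂ _+_ (cong₂ _+_ (cong bit (resp _ _ a≈b)) (cong bit (resp _ _ (+-≈ˡ 1 a≈b))))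
              (cong bit (resp _ _ (+-≈ˡ 2 a≈b)))

  χ-respects : ∀ S → Respects≈ (χ S)
  χ-respects S a b = χ-cong S {a} {b}

  χ-periodic : ∀ S → Periodic n (bit ∘ χ S)
  χ-periodic S m = cong bit (χ-cong S (+n≈ m))

  ∣∣≡sum<χ : ∀ S → ∣ S ∣ ≡ sum< (bit ∘ χ S) n
  ∣∣≡sum<χ S = ∣∣≡sum< S (χ S) (χ-toℕ S)

  χ-ext : ∀ S T → (∀ m → χ S m ≡ χ T m) → S ≡ T
  χ-ext S T eq = begin
      S                          ≡⟨ tabulate∘lookup S ⟨
      tabulate (lookup S)        ≡⟨ tabulate-cong (λ i → trans (sym (χ-toℕ S i)) (trans (eq (toℕ i)) (χ-toℕ T i))) ⟩
      tabulate (lookup T)        ≡⟨ tabulate∘lookup T ⟩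
      T                          ∎
    where open ≡-Reasoning

  fromSeq : (ℕ → Bool) → Subset n
  fromSeq g = tabulate (g ∘ toℕ)

  χ-fromSeq : ∀ g → Respects≈ g → ∀ m → χ (fromSeq g) m ≡ g m
  χ-fromSeq g resp m = trans (lookup∘tabulate (g ∘ toℕ) (m mod n)) (resp _ m (toℕ-mod-≈ m))

  Succ : Fin n → Fin n → Set
  Succ i j = suc (toℕ i) ≈ toℕ j

  ≡n∧≡0⇒≈ : ∀ {a b} → a ≡ n → b ≡ 0 → a ≈ b
  ≡n∧≡0⇒≈ a≡n b≡0 = trans (cong (_% n) a≡n) (trans n≈0 (cong (_% n) (sym b≡0)))

  Cycle⇒Succ : ∀ i j → Cycle n i j → Succ i j ⊎ Succ j i
  Cycle⇒Succ i j (inj₁ e)                      = inj₁ (cong (_% n) e)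
  Cycle⇒Succ i j (inj₂ (inj₁ e))               = inj₂ (cong (_% n) e)
  Cycle⇒Succ i j (inj₂ (inj₂ (inj₁ (i≡0 , e)))) = inj₂ (≡n∧≡0⇒≈ e i≡0)
  Cycle⇒Succ i j (inj₂ (inj₂ (inj₂ (j≡0 , e)))) = inj₁ (≡n∧≡0⇒≈ e j≡0)

  Succ⇒Cycle : ∀ i j → Succ i j → Cycle n i j
  Succ⇒Cycle i j i→j with m≤n⇒m<n∨m≡n (Finₚ.toℕ<n i)
  ... | inj₁ 1+i<n = inj₁ (≈⇒≡ 1+i<n (Finₚ.toℕ<n j) i→j)
  ... | inj₂ 1+i≡n = inj₂ (inj₂ (inj₂ (j≡0 , 1+i≡n)))
    where
    j≡0 : toℕ j ≡ 0
    j≡0 = ≈⇒≡ (Finₚ.toℕ<n j) (>-nonZero⁻¹ n) (trans (sym i→j) (trans (cong (_% n) 1+i≡n) n≈0))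

  Cycle-sym : ∀ i j → Cycle n i j → Cycle n j i
  Cycle-sym i j (inj₁ e)                 = inj₂ (inj₁ e)
  Cycle-sym i j (inj₂ (inj₁ e))          = inj₁ e
  Cycle-sym i j (inj₂ (inj₂ (inj₁ e)))   = inj₂ (inj₂ (inj₂ e))
  Cycle-sym i j (inj₂ (inj₂ (inj₂ e)))   = inj₂ (inj₂ (inj₁ e))

  Succ-mod : ∀ m → Succ (m mod n) (suc m mod n)
  Succ-mod m = trans (+-≈ˡ 1 (toℕ-mod-≈ m)) (sym (toℕ-mod-≈ (suc m)))

  independent⇒seq : ∀ S → Independent (Cycle n) S → IndependentSeq (χ S)
  independent⇒seq S ind m χm χ1+m =
    ind (m mod n) (suc m mod n) (χ⇒mod∈ m χm) (χ⇒mod∈ (suc m) χ1+m) (Succ⇒Cycle _ _ (Succ-mod m))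

  seq⇒independent : ∀ S → IndependentSeq (χ S) → Independent (Cycle n) S
  seq⇒independent S ind x y x∈S y∈S xy with Cycle⇒Succ x y xy
  ... | inj₁ x→y = ind (toℕ x) (∈⇒χ x∈S) (trans (χ-cong S x→y) (∈⇒χ y∈S))
  ... | inj₂ y→x = ind (toℕ y) (∈⇒χ y∈S) (trans (χ-cong S y→x) (∈⇒χ x∈S))

  dominating⇒seq : ∀ S → Dominating (Cycle n) S → DominatingSeq (χ S)
  dominating⇒seq S dom m = hit⇒window≥1 (χ S) m (hit (dom v))
    where
    v = suc m mod n
    v≈1+m : toℕ v ≈ suc m
    v≈1+m = toℕ-mod-≈ (suc m)
    hit : v ∈ S ⊎ ∃[ u ] (u ∈ S × Cycle n u v) → Hit (χ S) m
    hit (inj₁ v∈S) = inj₂ (inj₁ ([]=⇒lookup v∈S))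
    hit (inj₂ (u , u∈S , uv)) with Cycle⇒Succ u v uv
    ... | inj₁ u→v = inj₁ (trans (χ-cong S (+-cancelˡ-≈ 1 (trans (sym v≈1+m) (sym u→v)))) (∈⇒χ u∈S))
    ... | inj₂ v→u = inj₂ (inj₂ (trans (χ-cong S (trans (+-≈ˡ 1 (sym v≈1+m)) v→u)) (∈⇒χ u∈S)))

  seq⇒dominating : ∀ S → DominatingSeq (χ S) → Dominating (Cycle n) S
  seq⇒dominating S dom v = dominated (window≥1⇒hit (χ S) m (dom m))
    where
    m = toℕ v + (n ∸ 1)
    1+m≈v : suc m ≈ toℕ v
    1+m≈v = +∸-≈ (toℕ v) (>-nonZero⁻¹ n)
    dominated : Hit (χ S) m → v ∈ S ⊎ ∃[ u ] (u ∈ S × Cycle n u v)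
    dominated (inj₁ χm) =
      inj₂ (_ , χ⇒mod∈ m χm , Succ⇒Cycle _ v (trans (+-≈ˡ 1 (toℕ-mod-≈ m)) 1+m≈v))
    dominated (inj₂ (inj₁ χ1+m)) = inj₁ (χ⇒∈ (trans (χ-cong S (sym 1+m≈v)) χ1+m))
    dominated (inj₂ (inj₂ χ2+m)) =
      inj₂ (_ , χ⇒mod∈ (2 + m) χ2+m , Cycle-sym v _ (Succ⇒Cycle v _
        (trans (+-≈ˡ 1 (sym 1+m≈v)) (sym (toℕ-mod-≈ (2 + m))))))

  sum<-window-χ : ∀ S → sum< (window (χ S)) n ≡ 3 * ∣ S ∣
  sum<-window-χ S = trans (sum<-window n (χ S) (χ-periodic S)) (cong (3 *_) (sym (∣∣≡sum<χ S)))

  dominating⇒n≤3∣∣ : ∀ S → Dominating (Cycle n) S → n ≤ 3 * ∣ S ∣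
  dominating⇒n≤3∣∣ S dom = ≤-trans (sum<-positive (window (χ S)) n (λ m _ → dominating⇒seq S dom m))
                                    (≤-reflexive (sum<-window-χ S))

  χ-swap-new : ∀ X x y m → m ≈ toℕ y → χ (swap X x y) m ≡ true
  χ-swap-new X x y m m≈y rewrite ≈⇒mod≡ m≈y = lookup∘update y (X [ x ]≔ outside) inside

  χ-swap-old : ∀ X x y m → ¬ m ≈ toℕ y → m ≈ toℕ x → χ (swap X x y) m ≡ false
  χ-swap-old X x y m m≉y m≈x =
    trans (lookup∘update′ (m≉y ∘ mod≡⇒≈) (X [ x ]≔ outside) inside)
          (trans (cong (lookup (X [ x ]≔ outside)) (≈⇒mod≡ m≈x)) (lookup∘update x X outside))

  χ-swap-other : ∀ X x y m → ¬ m ≈ toℕ y → ¬ m ≈ toℕ x → χ (swap X x y) m ≡ χ X m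
  χ-swap-other X x y m m≉y m≉x =
    trans (lookup∘update′ (m≉y ∘ mod≡⇒≈) (X [ x ]≔ outside) inside)
          (lookup∘update′ (m≉x ∘ mod≡⇒≈) X outside)

  χ-swap-true : ∀ X x y m → χ (swap X x y) m ≡ true → m ≈ toℕ y ⊎ (¬ m ≈ toℕ x × χ X m ≡ true)
  χ-swap-true X x y m χm with m ≈? toℕ y | m ≈? toℕ x
  ... | yes m≈y | _       = inj₁ m≈y
  ... | no m≉y  | yes m≈x with () ← trans (sym χm) (χ-swap-old X x y m m≉y m≈x)
  ... | no m≉y  | no m≉x  = inj₂ (m≉x , trans (sym (χ-swap-other X x y m m≉y m≉x)) χm)

  slide-forward : 3 < n → ∀ X x y → IndependentSeq (χ X) → x ∈ X → Succ x y →
                  DominatingSeq (χ (swap X x y)) → χ X (toℕ x + (n ∸ 2)) ≡ true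
  slide-forward 3<n X x y ind x∈X x→y dom = hit (window≥1⇒hit (χ (swap X x y)) p (dom p))
    where
    p = toℕ x + (n ∸ 2)
    2<n = <-trans (n<1+n 2) 3<n
    2+p≈x : 2 + p ≈ toℕ x
    2+p≈x = +∸-≈ (toℕ x) (<⇒≤ 2<n)
    3+p≈y : 3 + p ≈ toℕ y
    3+p≈y = trans (+-≈ˡ 1 2+p≈x) x→y
    hit : Hit (χ (swap X x y)) p → χ X p ≡ true
    hit (inj₁ χp) with χ-swap-true X x y p χp
    ... | inj₁ p≈y         = ⊥-elim (+-≉ 3 p 3<n (trans 3+p≈y (sym p≈y)))
    ... | inj₂ (_ , χXp)   = χXp
    hit (inj₂ (inj₁ χ1+p)) with χ-swap-true X x y (suc p) χ1+p
    ... | inj₁ 1+p≈y       = ⊥-elim (+-≉ 2 (suc p) 2<n (trans 3+p≈y (sym 1+p≈y)))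
    ... | inj₂ (_ , χX1+p) = ⊥-elim (ind (suc p) χX1+p (trans (χ-cong X 2+p≈x) (∈⇒χ x∈X)))
    hit (inj₂ (inj₂ χ2+p)) with χ-swap-true X x y (2 + p) χ2+p
    ... | inj₁ 2+p≈y       = ⊥-elim (+-≉ 1 (2 + p) (<-trans (n<1+n 1) 2<n) (trans 3+p≈y (sym 2+p≈y)))
    ... | inj₂ (2+p≉x , _) = ⊥-elim (2+p≉x 2+p≈x)

  slide-backward : 3 < n → ∀ X x y → IndependentSeq (χ X) → x ∈ X → Succ y x →
                   DominatingSeq (χ (swap X x y)) → χ X (2 + toℕ x) ≡ true
  slide-backward 3<n X x y ind x∈X y→x dom = hit (window≥1⇒hit (χ (swap X x y)) (toℕ x) (dom (toℕ x)))
    where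
    2<n = <-trans (n<1+n 2) 3<n
    hit : Hit (χ (swap X x y)) (toℕ x) → χ X (2 + toℕ x) ≡ true
    hit (inj₁ χx) with χ-swap-true X x y (toℕ x) χx
    ... | inj₁ x≈y         = ⊥-elim (+-≉ 1 (toℕ y) (<-trans (n<1+n 1) 2<n) (trans y→x x≈y))
    ... | inj₂ (x≉x , _)   = ⊥-elim (x≉x refl)
    hit (inj₂ (inj₁ χ1+x)) with χ-swap-true X x y (suc (toℕ x)) χ1+x
    ... | inj₁ 1+x≈y       = ⊥-elim (+-≉ 2 (toℕ y) 2<n (trans (+-≈ˡ 1 y→x) 1+x≈y))
    ... | inj₂ (_ , χX1+x) = ⊥-elim (ind (toℕ x) (∈⇒χ x∈X) χX1+x)
    hit (inj₂ (inj₂ χ2+x)) with χ-swap-true X x y (2 + toℕ x) χ2+x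
    ... | inj₁ 2+x≈y       = ⊥-elim (+-≉ 3 (toℕ y) 3<n (trans (+-≈ˡ 2 y→x) 2+x≈y))
    ... | inj₂ (_ , χX2+x) = χX2+x

  -- After the move the vertex on the far side of x must still be dominated; as X is
  -- independent, this forces a second vertex of X at distance two from x.
  slide : 3 < n → ∀ X x y → IndependentSeq (χ X) → x ∈ X → Cycle n x y → DominatingSeq (χ (swap X x y)) →
          ∃[ p ] (χ X p ≡ true × χ X (2 + p) ≡ true
                  × (2 + p ≈ toℕ x × 3 + p ≈ toℕ y ⊎ p ≈ toℕ x × suc (toℕ y) ≈ p))
  slide 3<n X x y ind x∈X xy dom with Cycle⇒Succ x y xy
  ... | inj₁ x→y = toℕ x + (n ∸ 2) , slide-forward 3<n X x y ind x∈X x→y dom ,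
                   trans (χ-cong X 2+p≈x) (∈⇒χ x∈X) , inj₁ (2+p≈x , trans (+-≈ˡ 1 2+p≈x) x→y)
    where
    2+p≈x : 2 + (toℕ x + (n ∸ 2)) ≈ toℕ x
    2+p≈x = +∸-≈ (toℕ x) (<⇒≤ (<-trans (n<1+n 2) 3<n))
  ... | inj₂ y→x = toℕ x , ∈⇒χ x∈X , slide-backward 3<n X x y ind x∈X y→x dom , inj₂ (refl , y→x)

  window-χ-fromSeq : ∀ g → Respects≈ g → ∀ m → window (χ (fromSeq g)) m ≡ window g m
  window-χ-fromSeq g resp m =
    cong₂ _+_ (cong₂ _+_ (cong bit (χ-fromSeq g resp m)) (cong bit (χ-fromSeq g resp (suc m))))
              (cong bit (χ-fromSeq g resp (2 + m)))

  3∣∣≤n+2⇒ISet : ∀ S → IndependentSeq (χ S) → DominatingSeq (χ S) → 3 * ∣ S ∣ ≤ n + 2 →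
                 IsISet (Cycle n) S
  3∣∣≤n+2⇒ISet S ind dom 3∣S∣≤n+2 =
    (seq⇒independent S ind , seq⇒dominating S dom) ,
    λ T (_ , domT) → s≤s⁻¹ (*-cancelˡ-< 3 _ _ (begin-strict
      3 * ∣ S ∣        ≤⟨ 3∣S∣≤n+2 ⟩
      n + 2            ≤⟨ +-monoˡ-≤ 2 (dominating⇒n≤3∣∣ T domT) ⟩
      3 * ∣ T ∣ + 2    <⟨ +-monoʳ-< (3 * ∣ T ∣) (n<1+n 2) ⟩
      3 * ∣ T ∣ + 3    ≡⟨ +-comm (3 * ∣ T ∣) 3 ⟩
      3 + 3 * ∣ T ∣    ≡⟨ *-suc 3 ∣ T ∣ ⟨
      3 * suc ∣ T ∣    ∎))
    where open ≤-Reasoning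

  3∣∣≤n⇒windows≡1 : ∀ S → DominatingSeq (χ S) → 3 * ∣ S ∣ ≤ n → ∀ m → window (χ S) m ≡ 1
  3∣∣≤n⇒windows≡1 S dom 3∣S∣≤n m = trans (window-≈ (χ S) (χ-respects S) (sym (%-≈ m)))
    (sum<-positive-tight (window (χ S)) n (λ m _ → dom m)
      (≤-trans (≤-reflexive (sum<-window-χ S)) 3∣S∣≤n) (m % n) (m%n<n m n))

  excess-window-unique : ∀ S p → DominatingSeq (χ S) → 3 * ∣ S ∣ ≤ suc n → 2 ≤ window (χ S) p →
                         ∀ m → ¬ m ≈ p → window (χ S) m ≡ 1
  excess-window-unique S p dom 3∣S∣≤1+n 2≤Wp m m≉p =
    trans (window-≈ (χ S) (χ-respects S) (sym (%-negate-offset p m)))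
          (sum<-excess-at-0 shifted (pred n) (λ j _ → dom (j + p)) sum≤ 2≤Wp j 0<j j<n)
    where
    shifted : ℕ → ℕ
    shifted j = window (χ S) (j + p)
    j = (m + negate p) % n
    0<j : 0 < j
    0<j = n≢0⇒n>0 (λ j≡0 → m≉p (trans (sym (%-negate-offset p m)) (cong (λ t → (t + p) % n) j≡0)))
    j<n : j < suc (pred n)
    j<n = subst (j <_) (sym (suc-pred n)) (m%n<n _ n)
    periodic : Periodic n (window (χ S))
    periodic j = window-≈ (χ S) (χ-respects S) (+n≈ j)
    sum≤ : sum< shifted (suc (pred n)) ≤ 2 + pred n
    sum≤ = subst (λ L → sum< shifted L ≤ suc L) (sym (suc-pred n)) (begin
      sum< shifted n                         ≡⟨ sum<-cong n (λ j _ → cong (window (χ S)) (+-comm j p)) ⟩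
      sum< (λ j → window (χ S) (p + j)) n    ≡⟨ sum<-rotate n (window (χ S)) periodic p ⟩
      sum< (window (χ S)) n                  ≡⟨ sum<-window-χ S ⟩
      3 * ∣ S ∣                              ≤⟨ 3∣S∣≤1+n ⟩
      suc n                                  ∎)
      where open ≤-Reasoning

everyThird : ℕ → Bool
everyThird 0 = true
everyThird 1 = false
everyThird 2 = false
everyThird (suc (suc (suc m))) = everyThird m

everyThird-+*3 : ∀ r q → everyThird (r + q * 3) ≡ everyThird r
everyThird-+*3 r zero    = cong everyThird (+-identityʳ r)
everyThird-+*3 r (suc q) = trans (cong everyThird (x∙yz≈y∙xz r 3 (q * 3))) (everyThird-+*3 r q)

window-everyThird : ∀ m → window everyThird m ≡ 1
window-everyThird 0 = refl
window-everyThird 1 = refl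
window-everyThird 2 = refl
window-everyThird (suc (suc (suc m))) = window-everyThird m

module DivisibleByThree (k : ℕ) where

  n : ℕ
  n = suc k * 3

  open CycleSets n

  everyThird-% : ∀ a → everyThird a ≡ everyThird (a % n)
  everyThird-% a = begin
      everyThird a                              ≡⟨ cong everyThird (m≡m%n+[m/n]*n a n) ⟩
      everyThird (a % n + a / n * n)            ≡⟨ cong (λ t → everyThird (a % n + t)) (*-assoc (a / n) (suc k) 3) ⟨
      everyThird (a % n + a / n * suc k * 3)    ≡⟨ everyThird-+*3 (a % n) (a / n * suc k) ⟩
      everyThird (a % n)                        ∎
    where open ≡-Reasoning

  thirdsSeq : Fin 3 → ℕ → Bool
  thirdsSeq r m = everyThird (m + toℕ r)

  thirdsSeq-≈ : ∀ r → Respects≈ (thirdsSeq r)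
  thirdsSeq-≈ r a b a≈b = begin
      everyThird (a + toℕ r)          ≡⟨ everyThird-% (a + toℕ r) ⟩
      everyThird ((a + toℕ r) % n)    ≡⟨ cong everyThird (+-≈ʳ {a} {b} a≈b (toℕ r)) ⟩
      everyThird ((b + toℕ r) % n)    ≡⟨ everyThird-% (b + toℕ r) ⟨
      everyThird (b + toℕ r)          ∎
    where open ≡-Reasoning

  thirds : Fin 3 → Subset n
  thirds r = fromSeq (thirdsSeq r)

  window-thirds : ∀ r m → window (χ (thirds r)) m ≡ 1
  window-thirds r m = trans (window-χ-fromSeq (thirdsSeq r) (thirdsSeq-≈ r) m) (window-everyThird (m + toℕ r))

  3∣thirds∣≡n : ∀ r → 3 * ∣ thirds r ∣ ≡ n
  3∣thirds∣≡n r = trans (sym (sum<-window-χ (thirds r))) (sum<-ones _ n (λ m _ → window-thirds r m))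

  thirds-ISet : ∀ r → IsISet (Cycle n) (thirds r)
  thirds-ISet r = 3∣∣≤n+2⇒ISet (thirds r)
    (window≤1⇒independent _ (λ m → ≤-reflexive (window-thirds r m)))
    (λ m → ≤-reflexive (sym (window-thirds r m)))
    (≤-trans (≤-reflexive (3∣thirds∣≡n r)) (m≤m+n n 2))

  thirds-injective : ∀ i j → thirds i ≡ thirds j → i ≡ j
  thirds-injective i j eq = by-values-at-0-1 i j (agree 0) (agree 1)
    where
    agree : ∀ m → thirdsSeq i m ≡ thirdsSeq j m
    agree m = begin
        thirdsSeq i m        ≡⟨ χ-fromSeq (thirdsSeq i) (thirdsSeq-≈ i) m ⟨
        χ (thirds i) m       ≡⟨ cong (λ S → χ S m) eq ⟩
        χ (thirds j) m       ≡⟨ χ-fromSeq (thirdsSeq j) (thirdsSeq-≈ j) m ⟩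
        thirdsSeq j m        ∎
      where open ≡-Reasoning
    by-values-at-0-1 : ∀ i j → thirdsSeq i 0 ≡ thirdsSeq j 0 → thirdsSeq i 1 ≡ thirdsSeq j 1 → i ≡ j
    by-values-at-0-1 zero             zero             _ _ = refl
    by-values-at-0-1 (suc zero)       (suc zero)       _ _ = refl
    by-values-at-0-1 (suc (suc zero)) (suc (suc zero)) _ _ = refl
    by-values-at-0-1 zero             (suc zero)       () _
    by-values-at-0-1 zero             (suc (suc zero)) () _
    by-values-at-0-1 (suc zero)       zero             () _
    by-values-at-0-1 (suc (suc zero)) zero             () _
    by-values-at-0-1 (suc zero)       (suc (suc zero)) _ ()
    by-values-at-0-1 (suc (suc zero)) (suc zero)       _ ()

  ISet⇒thirds : ∀ S → IsISet (Cycle n) S → ∃[ r ] (thirds r ≡ S)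
  ISet⇒thirds S ((_ , domS) , minS) = by-first-window (χ S 0) (χ S 1) (χ S 2) refl refl refl (windows 0)
    where
    windows : ∀ m → window (χ S) m ≡ 1
    windows = 3∣∣≤n⇒windows≡1 S (dominating⇒seq S domS)
      (≤-trans (*-monoʳ-≤ 3 (minS (thirds zero) (proj₁ (thirds-ISet zero)))) (≤-reflexive (3∣thirds∣≡n zero)))
    matching : ∀ r → χ S 0 ≡ thirdsSeq r 0 → χ S 1 ≡ thirdsSeq r 1 → χ S 2 ≡ thirdsSeq r 2 →
               ∃[ r ] (thirds r ≡ S)
    matching r e₀ e₁ e₂ = r , χ-ext (thirds r) S λ m → trans (χ-fromSeq (thirdsSeq r) (thirdsSeq-≈ r) m)
      (sym (windows-agree (χ S) (thirdsSeq r) (λ m → trans (windows m) (sym (window-everyThird (m + toℕ r))))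
                          e₀ e₁ e₂ m))
    by-first-window : ∀ a b c → χ S 0 ≡ a → χ S 1 ≡ b → χ S 2 ≡ c → bit a + bit b + bit c ≡ 1 →
                      ∃[ r ] (thirds r ≡ S)
    by-first-window true  false false e₀ e₁ e₂ _ = matching zero e₀ e₁ e₂
    by-first-window false true  false e₀ e₁ e₂ _ = matching (suc (suc zero)) e₀ e₁ e₂
    by-first-window false false true  e₀ e₁ e₂ _ = matching (suc zero) e₀ e₁ e₂
    by-first-window true  true  _     _  _  _  ()
    by-first-window true  false true  _  _  _  ()
    by-first-window false true  true  _  _  _  ()
    by-first-window false false false _  _  _  ()

  thirds-not-IAdj : 3 < n → ∀ i j → ¬ IAdj (Cycle n) (thirds i) (thirds j)
  thirds-not-IAdj 3<n i j (x , y , xy , x∈ , y∉ , thirds-j≡swap)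
    with slide 3<n (thirds i) x y (window≤1⇒independent _ (λ m → ≤-reflexive (window-thirds i m))) x∈ xy
           (subst (DominatingSeq ∘ χ) thirds-j≡swap (λ m → ≤-reflexive (sym (window-thirds j m))))
  ... | p , χp , χ2+p , _
    with s≤s () ← subst (2 ≤_) (window-thirds i p) (101⇒window≥2 (χ (thirds i)) p χp χ2+p)

  iGraph≅3K₁ : 3 < n → IGraphIso (Cycle n) (Edgeless 3)
  iGraph≅3K₁ 3<n = thirds , thirds-ISet , thirds-injective _ _ , ISet⇒thirds ,
                   λ i j → mk⇔ (λ ()) (thirds-not-IAdj 3<n i j)

iGraph-C₃≅K₃ : IGraphIso (Cycle 3) (Complete 3)
iGraph-C₃≅K₃ = thirds , thirds-ISet , thirds-injective _ _ , ISet⇒thirds ,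
               λ i j → mk⇔ (adjacent i j) (λ ij i≡j →
                 IAdj-irreflexive (Cycle 3) (subst (λ k → IAdj (Cycle 3) (thirds k) (thirds j)) i≡j ij))
  where
  open DivisibleByThree 0
  in₀ : zero ∈ thirds zero
  in₀ = lookup⇒[]= zero (thirds zero) refl
  in₁ : suc (suc zero) ∈ thirds (suc zero)
  in₁ = lookup⇒[]= _ (thirds (suc zero)) refl
  in₂ : suc zero ∈ thirds (suc (suc zero))
  in₂ = lookup⇒[]= _ (thirds (suc (suc zero))) refl
  out : ∀ {X : Subset 3} {y} → lookup X y ≡ outside → y ∉ X
  out X[y]≡outside y∈X with () ← trans (sym X[y]≡outside) ([]=⇒lookup y∈X)
  adjacent : ∀ i j → Complete 3 i j → IAdj (Cycle 3) (thirds i) (thirds j)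
  adjacent zero             zero             i≢j = ⊥-elim (i≢j refl)
  adjacent (suc zero)       (suc zero)       i≢j = ⊥-elim (i≢j refl)
  adjacent (suc (suc zero)) (suc (suc zero)) i≢j = ⊥-elim (i≢j refl)
  adjacent zero             (suc zero)       _ =
    zero , suc (suc zero) , inj₂ (inj₂ (inj₁ (refl , refl))) , in₀ , out refl , refl
  adjacent zero             (suc (suc zero)) _ = zero , suc zero , inj₁ refl , in₀ , out refl , refl
  adjacent (suc zero)       zero             _ =
    suc (suc zero) , zero , inj₂ (inj₂ (inj₂ (refl , refl))) , in₁ , out refl , refl
  adjacent (suc zero)       (suc (suc zero)) _ = suc (suc zero) , suc zero , inj₂ (inj₁ refl) , in₁ , out refl , refl
  adjacent (suc (suc zero)) zero             _ = suc zero , zero , inj₂ (inj₁ refl) , in₂ , out refl , refl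
  adjacent (suc (suc zero)) (suc zero)       _ = suc zero , suc (suc zero) , inj₁ refl , in₂ , out refl , refl

module TwoModThree (k : ℕ) where

  n : ℕ
  n = 5 + k * 3

  open CycleSets n

  last : ℕ
  last = 4 + k * 3

  0<n : 0 < n
  0<n = z<s

  1<n : 1 < n
  1<n = s≤s (s≤s z≤n)

  2<n : 2 < n
  2<n = s≤s (s≤s (s≤s z≤n))

  3<n : 3 < n
  3<n = s≤s (s≤s (s≤s (s≤s z≤n)))

  -- base is {0, 2, 5, …, n − 3} on 0 … n − 1; its only window meeting it twice is the one at 0.
  base : ℕ → Bool
  base zero    = true
  base (suc d) = everyThird (suc (suc d))

  gap : ℕ → Bool
  gap a = base (a % n)

  gap-≈ : Respects≈ gap
  gap-≈ a b a≈b = cong base a≈b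

  gap-base : ∀ a d → a ≈ d → d < n → gap a ≡ base d
  gap-base a d a≈d d<n = cong base (trans a≈d (m<n⇒m%n≡m d<n))

  base-last : base last ≡ false
  base-last = everyThird-+*3 2 k

  window-gap-0 : ∀ a → a ≈ 0 → window gap a ≡ 2
  window-gap-0 a a≈0 = window-≈ gap gap-≈ {a} {0} a≈0

  window-gap-positive : ∀ d → 0 < d → d < n → window gap d ≡ 1
  window-gap-positive d 0<d d<n with m≤n⇒m<n∨m≡n d<n
  ... | inj₂ refl =
    window-from gap last (trans (gap-base last last refl d<n) base-last)
                (gap-base (suc last) 0 n≈0 0<n) (gap-base (2 + last) 1 (+n≈ 1) 1<n)
  ... | inj₁ 1+d<n with m≤n⇒m<n∨m≡n 1+d<n
  ...   | inj₂ refl =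
    window-from gap d (trans (gap-base d d refl d<n) (everyThird-+*3 1 k)) (trans (gap-base last last refl 1+d<n) base-last)
                      (gap-base (2 + d) 0 n≈0 0<n)
  window-gap-positive (suc d) _ d<n | inj₁ 1+d<n | inj₁ 2+d<n =
    trans (window-from gap (suc d) (gap-base (suc d) (suc d) refl d<n) (gap-base (2 + d) (2 + d) refl 1+d<n)
                       (gap-base (3 + d) (3 + d) refl 2+d<n))
          (window-everyThird (2 + d))

  window-gap-≉0 : ∀ a → ¬ a ≈ 0 → window gap a ≡ 1
  window-gap-≉0 a a≉0 = trans (window-≈ gap gap-≈ {a} {a % n} (sym (%-≈ a)))
                              (window-gap-positive (a % n) (n≢0⇒n>0 a≉0) (m%n<n a n))

  window-gap≥2⇒≈0 : ∀ a → 2 ≤ window gap a → a ≈ 0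
  window-gap≥2⇒≈0 a w≥2 with a ≈? 0
  ... | yes a≈0 = a≈0
  ... | no a≉0 with s≤s () ← subst (2 ≤_) (window-gap-≉0 a a≉0) w≥2

  gap-dominating : DominatingSeq gap
  gap-dominating a with a ≈? 0
  ... | yes a≈0 = ≤-trans (s≤s z≤n) (≤-reflexive (sym (window-gap-0 a a≈0)))
  ... | no a≉0  = ≤-reflexive (sym (window-gap-≉0 a a≉0))

  gap-independent : IndependentSeq gap
  gap-independent a ga g1+a with () ←
    trans (sym g1+a) (gap-base (suc a) 1 (+-≈ˡ 1 {a} {0} (window-gap≥2⇒≈0 a (11⇒window≥2 gap a ga g1+a))) 1<n)

  sum<-window-gap : sum< (window gap) n ≡ suc n
  sum<-window-gap = cong₂ _+_ (window-gap-0 0 refl)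
    (sum<-ones (window gap ∘ suc) last (λ m m<last → window-gap-positive (suc m) z<s (s<s m<last)))

  gap-3+-positive : ∀ d → 0 < d → suc d < n → gap (3 + d) ≡ base d
  gap-3+-positive d 0<d 1+d<n with m≤n⇒m<n∨m≡n 1+d<n
  ... | inj₂ refl = trans (gap-base (3 + d) 1 (+n≈ 1) 1<n) (sym (everyThird-+*3 1 k))
  ... | inj₁ 2+d<n with m≤n⇒m<n∨m≡n 2+d<n
  ...   | inj₂ refl = trans (gap-base n 0 n≈0 0<n) (sym (everyThird-+*3 0 k))
  gap-3+-positive (suc d) _ _ | inj₁ _ | inj₁ 3+d<n = gap-base (4 + d) (4 + d) refl 3+d<n

  gap-3+ : ∀ a → ¬ a ≈ 0 → ¬ a ≈ last → gap (3 + a) ≡ gap a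
  gap-3+ a a≉0 a≉last =
    trans (gap-≈ (3 + a) (3 + a % n) (+-≈ˡ 3 {a} {a % n} (sym (%-≈ a))))
          (gap-3+-positive (a % n) (n≢0⇒n>0 a≉0)
            (s≤s (≤∧≢⇒< (s≤s⁻¹ (m%n<n a n)) (λ a%n≡last → a≉last (trans a%n≡last (sym (m<n⇒m%n≡m ≤-refl)))))))

  rotSeq : ℕ → ℕ → Bool
  rotSeq c m = gap (m + c)

  rotSeq-≈ : ∀ c → Respects≈ (rotSeq c)
  rotSeq-≈ c a b a≈b = gap-≈ (a + c) (b + c) (+-≈ʳ {a} {b} a≈b c)

  rot : ℕ → Subset n
  rot c = fromSeq (rotSeq c)

  χ-rot : ∀ c m → χ (rot c) m ≡ gap (m + c)
  χ-rot c = χ-fromSeq (rotSeq c) (rotSeq-≈ c)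

  window-rot : ∀ c m → window (χ (rot c)) m ≡ window gap (m + c)
  window-rot c = window-χ-fromSeq (rotSeq c) (rotSeq-≈ c)

  rot-cong : ∀ {c c′} → c ≈ c′ → rot c ≡ rot c′
  rot-cong {c} {c′} c≈c′ =
    tabulate-cong (λ i → gap-≈ (toℕ i + c) (toℕ i + c′) (+-≈ˡ (toℕ i) {c} {c′} c≈c′))

  rot-pair : ∀ c p → χ (rot c) p ≡ true → χ (rot c) (2 + p) ≡ true → p + c ≈ 0
  rot-pair c p χp χ2+p =
    window-gap≥2⇒≈0 (p + c) (subst (2 ≤_) (window-rot c p) (101⇒window≥2 (χ (rot c)) p χp χ2+p))

  rot-injective : ∀ c c′ → rot c ≡ rot c′ → c ≈ c′
  rot-injective c c′ eq = +-cancelˡ-≈ (negate c) {c} {c′} (trans -c+c≈0 (sym -c+c′≈0))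
    where
    -c+c≈0 : negate c + c ≈ 0
    -c+c≈0 = trans (cong (_% n) (+-comm (negate c) c)) (+-negate c)
    -c+c′≈0 : negate c + c′ ≈ 0
    -c+c′≈0 = window-gap≥2⇒≈0 (negate c + c′) (≤-reflexive (begin
        2                                  ≡⟨ window-gap-0 (negate c + c) -c+c≈0 ⟨
        window gap (negate c + c)          ≡⟨ window-rot c (negate c) ⟨
        window (χ (rot c)) (negate c)      ≡⟨ cong (λ S → window (χ S) (negate c)) eq ⟩
        window (χ (rot c′)) (negate c)     ≡⟨ window-rot c′ (negate c) ⟩
        window gap (negate c + c′)         ∎))
      where open ≡-Reasoning

  rot-independent : ∀ c → IndependentSeq (χ (rot c))
  rot-independent c m χm χ1+m =
    gap-independent (m + c) (trans (sym (χ-rot c m)) χm) (trans (sym (χ-rot c (suc m))) χ1+m)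

  rot-dominating : ∀ c → DominatingSeq (χ (rot c))
  rot-dominating c m = subst (1 ≤_) (sym (window-rot c m)) (gap-dominating (m + c))

  3∣rot∣≡1+n : ∀ c → 3 * ∣ rot c ∣ ≡ suc n
  3∣rot∣≡1+n c = begin
      3 * ∣ rot c ∣                      ≡⟨ sum<-window-χ (rot c) ⟨
      sum< (window (χ (rot c))) n        ≡⟨ sum<-cong n (λ m _ → window-rot′ m) ⟩
      sum< (λ m → window gap (c + m)) n  ≡⟨ sum<-rotate n (window gap) periodic c ⟩
      sum< (window gap) n                ≡⟨ sum<-window-gap ⟩
      suc n                              ∎
    where
    open ≡-Reasoning
    window-rot′ : ∀ m → window (χ (rot c)) m ≡ window gap (c + m)
    window-rot′ m = trans (window-rot c m) (cong (window gap) (+-comm m c))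
    periodic : Periodic n (window gap)
    periodic m = window-≈ gap gap-≈ {m + n} {m} (+n≈ m)

  rot-ISet : ∀ c → IsISet (Cycle n) (rot c)
  rot-ISet c = 3∣∣≤n+2⇒ISet (rot c) (rot-independent c) (rot-dominating c)
    (≤-trans (≤-reflexive (3∣rot∣≡1+n c)) (≤-trans (n≤1+n (suc n)) (≤-reflexive (+-comm 2 n))))

  3*≢n : ∀ t → 3 * t ≢ n
  3*≢n t 3t≡n = 0≢2 (begin
      0                ≡⟨ m*n%n≡0 t 3 ⟨
      (t * 3) % 3      ≡⟨ cong (_% 3) (trans (*-comm t 3) 3t≡n) ⟩
      (5 + k * 3) % 3  ≡⟨ [m+kn]%n≡m%n 5 k 3 ⟩
      2                ∎)
    where
    open ≡-Reasoning
    0≢2 : 0 ≢ 2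
    0≢2 ()

  -- S and rot (negate p) have the same windows (2 at p, 1 elsewhere) and both read 1, 0, 1 at p,
  -- so windows-agree identifies them.
  excess-at⇒rot : ∀ S p → IndependentSeq (χ S) → DominatingSeq (χ S) → 3 * ∣ S ∣ ≤ suc n →
                  2 ≤ window (χ S) p → rot (negate p) ≡ S
  excess-at⇒rot S p ind dom 3∣S∣≤1+n 2≤Wp = χ-ext (rot c) S (λ m → sym (agree m))
    where
    c = negate p
    p+c≈0 : p + c ≈ 0
    p+c≈0 = +-negate p
    101-at-p : χ S p ≡ true × χ S (suc p) ≡ false × χ S (2 + p) ≡ true
    101-at-p = window≥2⇒101 (χ S) ind p 2≤Wp
    χ-rot-at : ∀ d → d < n → χ (rot c) (d + p) ≡ base d
    χ-rot-at d d<n = trans (χ-rot c (d + p))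
      (gap-base (d + p + c) d (trans (cong (_% n) (+-assoc d p c)) (trans (+-≈ˡ d {p + c} {0} p+c≈0)
                                     (cong (_% n) (+-identityʳ d)))) d<n)
    windows : ∀ m → window (χ S) m ≡ window (χ (rot c)) m
    windows m with m ≈? p
    ... | no m≉p = trans (excess-window-unique S p dom 3∣S∣≤1+n 2≤Wp m m≉p) (sym (trans (window-rot c m)
                     (window-gap-≉0 (m + c) (λ m+c≈0 → m≉p (+-cancelʳ-≈ c {m} {p} (trans m+c≈0 (sym p+c≈0)))))))
    ... | yes m≈p = begin
        window (χ S) m             ≡⟨ window-≈ (χ S) (χ-respects S) {m} {p} m≈p ⟩
        window (χ S) p             ≡⟨ window-from (χ S) p (proj₁ 101-at-p) (proj₁ (proj₂ 101-at-p))
                                                          (proj₂ (proj₂ 101-at-p)) ⟩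
        2                          ≡⟨ window-gap-0 (m + c) (trans (+-≈ʳ {m} {p} m≈p c) p+c≈0) ⟨
        window gap (m + c)         ≡⟨ window-rot c m ⟨
        window (χ (rot c)) m       ∎
      where open ≡-Reasoning
    from-p : ∀ j → χ S (j + p) ≡ χ (rot c) (j + p)
    from-p = windows-agree (λ j → χ S (j + p)) (λ j → χ (rot c) (j + p)) (λ j → windows (j + p))
      (trans (proj₁ 101-at-p) (sym (χ-rot-at 0 0<n)))
      (trans (proj₁ (proj₂ 101-at-p)) (sym (χ-rot-at 1 1<n)))
      (trans (proj₂ (proj₂ 101-at-p)) (sym (χ-rot-at 2 2<n)))
    agree : ∀ m → χ S m ≡ χ (rot c) m
    agree m = begin
        χ S m                           ≡⟨ χ-cong S {m} {j + p} (sym (%-negate-offset p m)) ⟩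
        χ S (j + p)                     ≡⟨ from-p j ⟩
        χ (rot c) (j + p)               ≡⟨ χ-cong (rot c) {j + p} {m} (%-negate-offset p m) ⟩
        χ (rot c) m                     ∎
      where
      open ≡-Reasoning
      j = (m + negate p) % n

  ISet⇒rot : ∀ S → IsISet (Cycle n) S → ∃[ c ] (rot c ≡ S)
  ISet⇒rot S ((indS , domS) , minS) with sum<-large (window (χ S)) n n<sum
    where
    n<sum : n < sum< (window (χ S)) n
    n<sum = subst (n <_) (sym (sum<-window-χ S))
              (≤∧≢⇒< (dominating⇒n≤3∣∣ S domS) (λ n≡3∣S∣ → 3*≢n ∣ S ∣ (sym n≡3∣S∣)))
  ... | p , _ , 2≤Wp = negate p , excess-at⇒rot S p (independent⇒seq S indS) (dominating⇒seq S domS)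
        (≤-trans (*-monoʳ-≤ 3 (minS (rot 0) (proj₁ (rot-ISet 0)))) (≤-reflexive (3∣rot∣≡1+n 0))) 2≤Wp

  predecessor-≈last : ∀ c a b → a + c ≈ 0 → suc b ≈ a → b + c ≈ last
  predecessor-≈last c a b a+c≈0 b→a =
    +-cancelˡ-≈ 1 {b + c} {last} (trans (+-≈ʳ {suc b} {a} b→a c) (trans a+c≈0 (sym n≈0)))

  χ-rot-3+ : ∀ c m → χ (rot (3 + c)) m ≡ gap (3 + (m + c))
  χ-rot-3+ c m = trans (χ-rot (3 + c) m) (cong gap (x∙yz≈y∙xz m 3 c))

  swap-rot : ∀ c x y → toℕ x + c ≈ 0 → suc (toℕ y) ≈ toℕ x → swap (rot c) x y ≡ rot (3 + c)
  swap-rot c x y x+c≈0 y→x = χ-ext (swap (rot c) x y) (rot (3 + c)) pointwise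
    where
    y+c≈last : toℕ y + c ≈ last
    y+c≈last = predecessor-≈last c (toℕ x) (toℕ y) x+c≈0 y→x
    pointwise : ∀ m → χ (swap (rot c) x y) m ≡ χ (rot (3 + c)) m
    pointwise m with m ≈? toℕ y | m ≈? toℕ x
    ... | yes m≈y | _ = trans (χ-swap-new (rot c) x y m m≈y) (sym (trans (χ-rot-3+ c m)
          (gap-base (3 + (m + c)) 2 (trans (+-≈ˡ 3 {m + c} {last} (trans (+-≈ʳ {m} {toℕ y} m≈y c) y+c≈last))
                                           (+n≈ 2)) 2<n)))
    ... | no m≉y | yes m≈x = trans (χ-swap-old (rot c) x y m m≉y m≈x) (sym (trans (χ-rot-3+ c m)
          (gap-base (3 + (m + c)) 3 (+-≈ˡ 3 {m + c} {0} (trans (+-≈ʳ {m} {toℕ x} m≈x c) x+c≈0)) 3<n)))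
    ... | no m≉y | no m≉x =
      trans (χ-swap-other (rot c) x y m m≉y m≉x) (trans (χ-rot c m) (sym (trans (χ-rot-3+ c m)
          (gap-3+ (m + c) (λ m+c≈0 → m≉x (+-cancelʳ-≈ c {m} {toℕ x} (trans m+c≈0 (sym x+c≈0))))
                          (λ m+c≈last → m≉y (+-cancelʳ-≈ c {m} {toℕ y} (trans m+c≈last (sym y+c≈last))))))))

  ∈rot : ∀ c {x} → toℕ x + c ≈ 0 → x ∈ rot c
  ∈rot c {x} x+c≈0 = χ⇒∈ (trans (χ-rot c (toℕ x)) (gap-base (toℕ x + c) 0 x+c≈0 0<n))

  ∉rot : ∀ c {y} → toℕ y + c ≈ last → y ∉ rot c
  ∉rot c {y} y+c≈last y∈ with () ← trans (sym (∈⇒χ y∈))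
    (trans (χ-rot c (toℕ y)) (trans (gap-base (toℕ y + c) last y+c≈last ≤-refl) base-last))

  rot-step : ∀ c → ∃[ x ] ∃[ y ] (Cycle n y x × x ∈ rot c × y ∉ rot c × swap (rot c) x y ≡ rot (3 + c))
  rot-step c = x , y , Succ⇒Cycle y x y→x , ∈rot c x+c≈0 , ∉rot c (predecessor-≈last c (toℕ x) (toℕ y) x+c≈0 y→x) ,
               swap-rot c x y x+c≈0 y→x
    where
    x = negate c mod n
    y = (negate c + last) mod n
    x+c≈0 : toℕ x + c ≈ 0
    x+c≈0 = trans (+-≈ʳ {toℕ x} {negate c} (toℕ-mod-≈ (negate c)) c) (negate-+ c)
    y→x : suc (toℕ y) ≈ toℕ x
    y→x = begin
        suc (toℕ y) % n          ≡⟨ +-≈ˡ 1 {toℕ y} {negate c + last} (toℕ-mod-≈ (negate c + last)) ⟩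
        suc (negate c + last) % n ≡⟨ cong (_% n) (sym (+-suc (negate c) last)) ⟩
        (negate c + n) % n       ≡⟨ +n≈ (negate c) ⟩
        negate c % n             ≡⟨ toℕ-mod-≈ (negate c) ⟨
        toℕ x % n                ∎
      where open ≡-Reasoning

  rot-IAdj-3+ : ∀ c → IAdj (Cycle n) (rot c) (rot (3 + c))
  rot-IAdj-3+ c = let (x , y , yx , x∈ , y∉ , eq) = rot-step c
                  in subst (IAdj (Cycle n) (rot c)) eq (swap-IAdj (Cycle n) (Cycle-sym y x yx) x∈ y∉)

  rot-IAdj-3+⁻ : ∀ c → IAdj (Cycle n) (rot (3 + c)) (rot c)
  rot-IAdj-3+⁻ c = let (x , y , yx , x∈ , y∉ , eq) = rot-step c
                   in subst (λ Z → IAdj (Cycle n) Z (rot c)) eq (swap-IAdj⁻ (Cycle n) yx x∈ y∉)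

  -- The only members of rot c at distance two are p and p + 2 with p + c ≈ 0, so by slide a move
  -- out of rot c is either p ↦ p − 1, reaching rot (3 + c), or p + 2 ↦ p + 3, reaching rot (c − 3).
  rot-IAdj⇒ : 3 < n → ∀ c d → IAdj (Cycle n) (rot c) (rot d) → 3 + c ≈ d ⊎ 3 + d ≈ c
  rot-IAdj⇒ 3<n c d (x , y , xy , x∈ , y∉ , rot-d≡swap)
    with slide 3<n (rot c) x y (rot-independent c) x∈ xy (subst (DominatingSeq ∘ χ) rot-d≡swap (rot-dominating d))
  ... | p , χp , χ2+p , inj₂ (p≈x , y→p) =
    inj₁ (sym (rot-injective d (3 + c) (trans rot-d≡swap (swap-rot c x y x+c≈0 (trans y→p p≈x)))))
    where
    x+c≈0 : toℕ x + c ≈ 0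
    x+c≈0 = trans (+-≈ʳ {toℕ x} {p} (sym p≈x) c) (rot-pair c p χp χ2+p)
  ... | p , χp , χ2+p , inj₁ (2+p≈x , 3+p≈y) =
    inj₂ (trans (+-≈ˡ 3 {d} {c′} (rot-injective d c′ rot-d≡rot-c′)) 3+c′≈c)
    where
    c′ = c + (2 + k * 3)
    3+c′≈c : 3 + c′ ≈ c
    3+c′≈c = trans (cong (_% n) (x∙yz≈y∙xz 3 c (2 + k * 3))) (+n≈ c)
    y+c′≈0 : toℕ y + c′ ≈ 0
    y+c′≈0 = begin
        (toℕ y + c′) % n      ≡⟨ +-≈ʳ {toℕ y} {3 + p} (sym 3+p≈y) c′ ⟩
        (3 + (p + c′)) % n    ≡⟨ cong (_% n) (x∙yz≈y∙xz 3 p c′) ⟩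
        (p + (3 + c′)) % n    ≡⟨ +-≈ˡ p {3 + c′} {c} 3+c′≈c ⟩
        (p + c) % n           ≡⟨ rot-pair c p χp χ2+p ⟩
        0                     ∎
      where open ≡-Reasoning
    x→y : suc (toℕ x) ≈ toℕ y
    x→y = trans (+-≈ˡ 1 {toℕ x} {2 + p} (sym 2+p≈x)) 3+p≈y
    rot-c≡swap : rot c ≡ swap (rot c′) y x
    rot-c≡swap = trans (rot-cong {c} {3 + c′} (sym 3+c′≈c)) (sym (swap-rot c′ y x y+c′≈0 x→y))
    rot-d≡rot-c′ : rot d ≡ rot c′
    rot-d≡rot-c′ = begin
        rot d                          ≡⟨ rot-d≡swap ⟩
        swap (rot c) x y               ≡⟨ cong (λ Z → swap Z x y) rot-c≡swap ⟩
        swap (swap (rot c′) y x) x y   ≡⟨ swap-swap (rot c′) (∈rot c′ y+c′≈0)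
                                            (∉rot c′ (predecessor-≈last c′ (toℕ y) (toℕ x) y+c′≈0 x→y)) ⟩
        rot c′                         ∎
      where open ≡-Reasoning

  *suc-n≈ : ∀ a → a * suc n ≈ a
  *suc-n≈ a = trans (cong (_% n) (*-suc a n)) ([m+kn]%n≡m%n a a n)

  -- 3 (2 + k) = n + 1, so 2 + k inverts 3 modulo n.
  *3-cancel : ∀ a b → a * 3 ≈ b * 3 → a ≈ b
  *3-cancel a b a3≈b3 =
    trans (sym (times-inverse a)) (trans (*-≈ {a * 3} {b * 3} {2 + k} {2 + k} a3≈b3 refl) (times-inverse b))
    where
    times-inverse : ∀ a → a * 3 * (2 + k) ≈ a
    times-inverse a = trans (cong (_% n) (trans (*-assoc a 3 (2 + k)) (cong (a *_) (*-comm 3 (2 + k))))) (*suc-n≈ a)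

  ι : Fin n → Subset n
  ι i = rot (toℕ i * 3)

  ι-injective : ∀ i j → ι i ≡ ι j → i ≡ j
  ι-injective i j eq = Finₚ.toℕ-injective
    (≈⇒≡ (Finₚ.toℕ<n i) (Finₚ.toℕ<n j) (*3-cancel (toℕ i) (toℕ j) (rot-injective (toℕ i * 3) (toℕ j * 3) eq)))

  rot⇒ι : ∀ c → ∃[ i ] (ι i ≡ rot c)
  rot⇒ι c = i , rot-cong {toℕ i * 3} {c} i3≈c
    where
    i = (c * (2 + k)) mod n
    i3≈c : toℕ i * 3 ≈ c
    i3≈c = trans (*-≈ {toℕ i} {c * (2 + k)} {3} {3} (toℕ-mod-≈ (c * (2 + k))) refl)
                 (trans (cong (_% n) (*-assoc c (2 + k) 3)) (*suc-n≈ c))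

  ISet⇒ι : ∀ S → IsISet (Cycle n) S → ∃[ i ] (ι i ≡ S)
  ISet⇒ι S iset = let (c , rot-c≡S) = ISet⇒rot S iset
                      (i , ι-i≡rot-c) = rot⇒ι c
                  in i , trans ι-i≡rot-c rot-c≡S

  Succ⇒ι-step : ∀ i j → Succ i j → ι j ≡ rot (3 + toℕ i * 3)
  Succ⇒ι-step i j i→j =
    rot-cong {toℕ j * 3} {suc (toℕ i) * 3} (*-≈ {toℕ j} {suc (toℕ i)} {3} {3} (sym i→j) refl)

  ι-step⇒Succ : ∀ i j → 3 + toℕ i * 3 ≈ toℕ j * 3 → Succ i j
  ι-step⇒Succ i j = *3-cancel (suc (toℕ i)) (toℕ j)

  ι-IAdj⇔Cycle : 3 < n → ∀ i j → Cycle n i j ⇔ IAdj (Cycle n) (ι i) (ι j)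
  ι-IAdj⇔Cycle 3<n i j = mk⇔ to from
    where
    to : Cycle n i j → IAdj (Cycle n) (ι i) (ι j)
    to ij with Cycle⇒Succ i j ij
    ... | inj₁ i→j = subst (IAdj (Cycle n) (ι i)) (sym (Succ⇒ι-step i j i→j)) (rot-IAdj-3+ (toℕ i * 3))
    ... | inj₂ j→i =
      subst (λ Z → IAdj (Cycle n) Z (ι j)) (sym (Succ⇒ι-step j i j→i)) (rot-IAdj-3+⁻ (toℕ j * 3))
    from : IAdj (Cycle n) (ι i) (ι j) → Cycle n i j
    from ιij with rot-IAdj⇒ 3<n (toℕ i * 3) (toℕ j * 3) ιij
    ... | inj₁ step = Succ⇒Cycle i j (ι-step⇒Succ i j step)
    ... | inj₂ step = Cycle-sym j i (Succ⇒Cycle j i (ι-step⇒Succ j i step))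

  iGraph≅Cₙ : IGraphIso (Cycle n) (Cycle n)
  iGraph≅Cₙ = ι , (λ i → rot-ISet (toℕ i * 3)) , ι-injective _ _ , ISet⇒ι , ι-IAdj⇔Cycle 3<n

multiple-of-3 : ∀ {n} k → n ≡ 3 * k → 6 ≤ n → ∃[ k′ ] (n ≡ suc k′ * 3)
multiple-of-3 zero    n≡0  6≤n with () ← subst (6 ≤_) (trans n≡0 (*-zeroʳ 3)) 6≤n
multiple-of-3 (suc k) n≡3k _   = k , trans n≡3k (*-comm 3 (suc k))

two-mod-3 : ∀ {n} → 3 ≤ n → n % 3 ≡ 2 → ∃[ k′ ] (n ≡ 5 + k′ * 3)
two-mod-3 {n} 3≤n n%3≡2 with n / 3 | trans (m≡m%n+[m/n]*n n 3) (cong (_+ n / 3 * 3) n%3≡2)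
... | zero  | n≡2 with s≤s (s≤s ()) ← subst (3 ≤_) (trans n≡2 (+-identityʳ 2)) 3≤n
... | suc k | n≡5+3k = k , n≡5+3k

mainTheorem10 : (n k : ℕ) → 3 ≤ n →
    (n ≡ 3 → IGraphIso (Cycle n) (Complete 3))
    × (n ≡ 3 * k → 6 ≤ n → IGraphIso (Cycle n) (Edgeless 3))
    × (n % 3 ≡ 2 → IGraphIso (Cycle n) (Cycle n))
mainTheorem10 n k 3≤n = (λ { refl → iGraph-C₃≅K₃ }) , three-divides , two-mod-three
  where
  three-divides : n ≡ 3 * k → 6 ≤ n → IGraphIso (Cycle n) (Edgeless 3)
  three-divides n≡3k 6≤n =
    let (k′ , n≡) = multiple-of-3 k n≡3k 6≤n
    in subst (λ m → IGraphIso (Cycle m) (Edgeless 3)) (sym n≡)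
             (DivisibleByThree.iGraph≅3K₁ k′ (≤-trans (s≤s (s≤s (s≤s (s≤s z≤n)))) (subst (6 ≤_) n≡ 6≤n)))
  two-mod-three : n % 3 ≡ 2 → IGraphIso (Cycle n) (Cycle n)
  two-mod-three n%3≡2 =
    let (k′ , n≡) = two-mod-3 3≤n n%3≡2
    in subst (λ m → IGraphIso (Cycle m) (Cycle m)) (sym n≡) (TwoModThree.iGraph≅Cₙ k′)
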